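{- Let $(N,T,f)$ be a linear game ladder. Then $\succ$ is transitive: for all $i,j,k\in N$, if $i\succ j$ and $j\succ k$ then $i\succ k$.
   Context: A game ladder is a triple $(N,T,f)$ where $N=\{1,\dots,n\}$ is a non-empty finite set of players, $T=\{1,\dots,m\}$ with $m\ge 2$ is an ordered set of positions (higher index = more important position), and $f:T^N\to\mathbb{R}$ is monotonic: for all $x,z\in T^N$ with $x\le z$ componentwise, $f(x)\le f(z)$. For $p\in N$, $e^p$ denotes the $p$-th unit vector. For players $p,q$ and positions $r>s$ in $T$, write $p\succeq_{(r,s)}q$ if for every $x\in T^N$ with $x_p=x_q=s$ one has $f(x+(r-s)e^p)\ge f(x+(r-s)e^q)$. Write $p\succeq q$ if $p\succeq_{(r,s)}q$ for all $r,s\in T$ with $r>s$; $p\succ q$ means $p\succeq q$ and not $q\succeq p$. The game ladder is linear if $\succeq$ is complete, i.e. for all $p,q\in N$, $p\succeq q$ or $q\succeq p$. -}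

module Defs where

open import Level using (Level; _⊔_)
open import Data.Nat using (ℕ; _≤_)
open import Data.Fin using (Fin; _≟_) renaming (_≤_ to _≤ᶠ_; _<_ to _<ᶠ_)
open import Data.Bool using (if_then_else_)
open import Data.Product using (_×_)
open import Data.Sum using (_⊎_)
open import Relation.Nullary using (¬_)
open import Relation.Nullary.Decidable using (⌊_⌋)
open import Relation.Binary.PropositionalEquality using (_≡_)
open import Relation.Binary.Bundles using (TotalOrder)

-- Players N = Fin n, positions T = Fin m (ordered by Fin's ≤, i.e. the
-- usual order on {1..m} shifted to {0..m-1}).  The real-valued codomain of f is generalised
-- to an arbitrary total order O.

Profile : ℕ → ℕ → Set
Profile n m = Fin n → Fin m

-- x + (r - s) e^p  when x_p = s : replace coordinate p of x by r.
upd : ∀ {n m} → Profile n m → Fin n → Fin m → Profile n m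
upd x p r q = if ⌊ q ≟ p ⌋ then r else x q

record GameLadder {c ℓ₁ ℓ₂ : Level} (O : TotalOrder c ℓ₁ ℓ₂) : Set (c ⊔ ℓ₂) where
  open TotalOrder O renaming (Carrier to ℝ′; _≤_ to _≤ᴼ_)
  field
    n         : ℕ
    m         : ℕ
    nonEmpty  : 1 ≤ n
    twoPos    : 2 ≤ m
    f         : Profile n m → ℝ′
    monotone  : ∀ (x z : Profile n m) → (∀ p → x p ≤ᶠ z p) → f x ≤ᴼ f z

  _⪰⟨_,_⟩_ : Fin n → Fin m → Fin m → Fin n → Set ℓ₂
  p ⪰⟨ r , s ⟩ q = ∀ (x : Profile n m) → x p ≡ s → x q ≡ s →
                   f (upd x q r) ≤ᴼ f (upd x p r)

  _⪰_ : Fin n → Fin n → Set ℓ₂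
  p ⪰ q = ∀ (r s : Fin m) → s <ᶠ r → p ⪰⟨ r , s ⟩ q

  _≻_ : Fin n → Fin n → Set ℓ₂
  p ≻ q = (p ⪰ q) × ¬ (q ⪰ p)

  Linear : Set ℓ₂
  Linear = ∀ (p q : Fin n) → (p ⪰ q) ⊎ (q ⪰ p)

-- Read p ⪰ q as a swap property: exchanging a lower position held by p with a
-- higher one held by q never decreases f.  If a ⪰ b ⪰ c ⪰ a, fix all players
-- but a, b, c and view f as a function g of their three positions; the three
-- swap properties of g, chained according to where the position of a lies
-- relative to the other two, yield c ⪰ b.  Hence, if i ≻ j ≻ k, then k ⪰ i
-- would give k ⪰ j, so linearity forces i ⪰ k.
module Submission where

open import Defs
open import Level using (Level)
open import Data.Nat using (ℕ)
open import Function using (id; _∘_)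
open import Data.Fin using (Fin; _≟_) renaming (_<_ to _<ᶠ_)
open import Data.Fin.Properties using (≤-reflexive; <-isStrictTotalOrder)
open import Data.Product using (_,_)
open import Data.Sum using (_⊎_; [_,_]′)
open import Data.Empty using (⊥-elim)
open import Relation.Nullary using (¬_; yes; no; contradiction)
open import Relation.Binary.Core using (Rel)
open import Relation.Binary.Bundles using (Preorder; TotalOrder)
open import Relation.Binary.Structures using (IsStrictTotalOrder)
open import Relation.Binary.Construct.Closure.Reflexive using (ReflClosure; refl; [_])
import Relation.Binary.Construct.Closure.Reflexive.Properties as ReflClosure
open import Relation.Binary.PropositionalEquality
  using (_≡_; _≢_; _≗_; refl; sym; trans; ≢-sym)
import Relation.Binary.Reasoning.Preorder as PreorderReasoning

module _ {a ℓ b ℓ₁ ℓ₂} {A : Set a} {_<_ : Rel A ℓ}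
         (<-isSTO : IsStrictTotalOrder _≡_ _<_) (B : Preorder b ℓ₁ ℓ₂) where
  open IsStrictTotalOrder <-isSTO using (compare) renaming (trans to <-trans)
  open Preorder B using (Carrier; _≲_) renaming (refl to ≲-refl)
  open PreorderReasoning B

  private
    _≤_ : Rel A _
    _≤_ = ReflClosure _<_

    ≤-trans : ∀ {x y z} → x ≤ y → y ≤ z → x ≤ z
    ≤-trans = ReflClosure.trans <-trans

    ≤-total : ∀ x y → x ≤ y ⊎ y ≤ x
    ≤-total = ReflClosure.total compare

  cyclic-dominance-reverses :
    (g : A → A → A → Carrier) →
    (∀ {lo hi} γ → lo < hi → g lo hi γ ≲ g hi lo γ) →
    (∀ {lo hi} α → lo < hi → g α lo hi ≲ g α hi lo) →
    (∀ {lo hi} β → lo < hi → g hi β lo ≲ g lo β hi) →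
    ∀ {s r} v → s < r → g v r s ≲ g v s r
  cyclic-dominance-reverses g ab bc ca {s} {r} v s<r =
    [ below , (λ s≤v → [ between s≤v , above ]′ (≤-total v r)) ]′ (≤-total v s)
    where
    ab≤ : ∀ {lo hi} γ → lo ≤ hi → g lo hi γ ≲ g hi lo γ
    ab≤ γ refl       = ≲-refl
    ab≤ γ [ lo<hi ]  = ab γ lo<hi

    bc≤ : ∀ {lo hi} α → lo ≤ hi → g α lo hi ≲ g α hi lo
    bc≤ α refl       = ≲-refl
    bc≤ α [ lo<hi ]  = bc α lo<hi

    ca≤ : ∀ {lo hi} β → lo ≤ hi → g hi β lo ≲ g lo β hi
    ca≤ β refl       = ≲-refl
    ca≤ β [ lo<hi ]  = ca β lo<hi

    below : v ≤ s → g v r s ≲ g v s r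
    below v≤s = begin
      g v r s  ≲⟨ ab≤ s v≤r ⟩
      g r v s  ≲⟨ bc≤ r v≤s ⟩
      g r s v  ≲⟨ ca≤ s v≤r ⟩
      g v s r  ∎
      where
      v≤r : v ≤ r
      v≤r = ≤-trans v≤s [ s<r ]

    between : s ≤ v → v ≤ r → g v r s ≲ g v s r
    between s≤v v≤r = begin
      g v r s  ≲⟨ ca≤ r s≤v ⟩
      g s r v  ≲⟨ ab v s<r ⟩
      g r s v  ≲⟨ ca≤ s v≤r ⟩
      g v s r  ∎

    above : r ≤ v → g v r s ≲ g v s r
    above r≤v = begin
      g v r s  ≲⟨ ca≤ r s≤v ⟩
      g s r v  ≲⟨ ab v s<r ⟩
      g r s v  ≲⟨ bc≤ r s≤v ⟩
      g r v s  ≲⟨ ca v s<r ⟩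
      g s v r  ≲⟨ ab≤ r s≤v ⟩
      g v s r  ∎
      where
      s≤v : s ≤ v
      s≤v = ≤-trans [ s<r ] r≤v

module _ {n m : ℕ} where

  upd-≡ : ∀ (x : Profile n m) p r → upd x p r p ≡ r
  upd-≡ x p r with p ≟ p
  ... | yes _   = refl
  ... | no p≢p  = contradiction refl p≢p

  upd-≢ : ∀ (x : Profile n m) {p q} r → q ≢ p → upd x p r q ≡ x q
  upd-≢ x {p} {q} r q≢p with q ≟ p
  ... | yes q≡p = contradiction q≡p q≢p
  ... | no _    = refl

  upd-self : ∀ {x : Profile n m} {p r} → x p ≡ r → upd x p r ≗ x
  upd-self {p = p} xp≡r o with o ≟ p
  ... | yes refl = sym xp≡r
  ... | no _     = refl

  upd-cong : ∀ {x y : Profile n m} {p r} → x ≗ y → upd x p r ≗ upd y p r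
  upd-cong {p = p} x≗y o with o ≟ p
  ... | yes _ = refl
  ... | no _  = x≗y o

  upd-idem : ∀ {x : Profile n m} {p r s} → upd (upd x p r) p s ≗ upd x p s
  upd-idem {p = p} o with o ≟ p
  ... | yes _ = refl
  ... | no _  = refl

  upd-comm : ∀ {x : Profile n m} {p q r s} → p ≢ q →
             upd (upd x p r) q s ≗ upd (upd x q s) p r
  upd-comm {p = p} {q} p≢q o with o ≟ p | o ≟ q
  ... | yes refl | yes refl = contradiction refl p≢q
  ... | yes _    | no _     = refl
  ... | no _     | yes _    = refl
  ... | no _     | no _     = refl

  upd-rotate : ∀ {x : Profile n m} {a b c α β γ} → a ≢ c → b ≢ c →
               upd (upd (upd x a α) b β) c γ ≗ upd (upd (upd x c γ) a α) b β
  upd-rotate {x} {a} {α = α} a≢c b≢c o =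
    trans (upd-comm {x = upd x a α} b≢c o) (upd-cong (upd-comm {x = x} a≢c) o)

module _ {o ℓ₁ ℓ₂} {O : TotalOrder o ℓ₁ ℓ₂} (G : GameLadder O) where
  open GameLadder G
  open TotalOrder O using (preorder)
    renaming (_≤_ to _≤ᴼ_; refl to ≤ᴼ-refl; trans to ≤ᴼ-trans)

  f-≤-resp-≗ : ∀ {y y′ z z′ : Profile n m} → y ≗ y′ → z ≗ z′ → f y′ ≤ᴼ f z′ → f y ≤ᴼ f z
  f-≤-resp-≗ {y} {y′} {z} {z′} y≗y′ z≗z′ fy′≤fz′ =
    ≤ᴼ-trans (monotone y y′ (≤-reflexive ∘ y≗y′))
      (≤ᴼ-trans fy′≤fz′ (monotone z′ z (≤-reflexive ∘ sym ∘ z≗z′)))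

  ⪰-refl : ∀ p → p ⪰ p
  ⪰-refl p r s _ x _ _ = ≤ᴼ-refl

  ⪰⇒swap : ∀ {p q lo hi} {y : Profile n m} → p ⪰ q → p ≢ q → lo <ᶠ hi →
           f (upd (upd y p lo) q hi) ≤ᴼ f (upd (upd y p hi) q lo)
  ⪰⇒swap {p} {q} {lo} {hi} {y} p⪰q p≢q lo<hi =
    f-≤-resp-≗ (sym ∘ upd-idem) swapped
      (p⪰q hi lo lo<hi z zp≡lo (upd-≡ (upd y p lo) q lo))
    where
    z : Profile n m
    z = upd (upd y p lo) q lo

    zp≡lo : z p ≡ lo
    zp≡lo = trans (upd-≢ (upd y p lo) lo p≢q) (upd-≡ y p lo)

    swapped : upd (upd y p hi) q lo ≗ upd z p hi
    swapped o = sym (trans (upd-comm {x = upd y p lo} (≢-sym p≢q) o)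
                           (upd-cong (upd-idem {x = y}) o))

  ⪰-cycle-reverse-distinct : ∀ {a b c} → a ≢ b → b ≢ c → c ≢ a →
                             a ⪰ b → b ⪰ c → c ⪰ a → c ⪰ b
  ⪰-cycle-reverse-distinct {a} {b} {c} a≢b b≢c c≢a a⪰b b⪰c c⪰a r s s<r x xc≡s xb≡s =
    f-≤-resp-≗ b-raised c-raised
      (cyclic-dominance-reverses <-isStrictTotalOrder preorder
        (λ α β γ → f (P α β γ)) ab bc ca (x a) s<r)
    where
    P : Fin m → Fin m → Fin m → Profile n m
    P α β γ = upd (upd (upd x a α) b β) c γ

    ab : ∀ {lo hi} γ → lo <ᶠ hi → f (P lo hi γ) ≤ᴼ f (P hi lo γ)
    ab γ lo<hi = f-≤-resp-≗ (upd-rotate (≢-sym c≢a) b≢c) (upd-rotate (≢-sym c≢a) b≢c)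
                   (⪰⇒swap a⪰b a≢b lo<hi)

    bc : ∀ {lo hi} α → lo <ᶠ hi → f (P α lo hi) ≤ᴼ f (P α hi lo)
    bc α = ⪰⇒swap b⪰c b≢c

    rotate² : ∀ {α β γ} → P α β γ ≗ upd (upd (upd x b β) c γ) a α
    rotate² o = trans (upd-rotate {x = x} (≢-sym c≢a) b≢c o)
                      (upd-rotate {x = x} (≢-sym b≢c) a≢b o)

    ca : ∀ {lo hi} β → lo <ᶠ hi → f (P hi β lo) ≤ᴼ f (P lo β hi)
    ca β lo<hi = f-≤-resp-≗ rotate² rotate² (⪰⇒swap c⪰a c≢a lo<hi)

    untouched-a : ∀ {β γ} → P (x a) β γ ≗ upd (upd x b β) c γ
    untouched-a = upd-cong (upd-cong (upd-self {x = x} refl))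

    b-raised : upd x b r ≗ P (x a) r s
    b-raised o = sym (trans (untouched-a o)
                            (upd-self (trans (upd-≢ x r (≢-sym b≢c)) xc≡s) o))

    c-raised : upd x c r ≗ P (x a) s r
    c-raised o = sym (trans (untouched-a o) (upd-cong (upd-self xb≡s) o))

  ⪰-cycle-reverse : ∀ {a b c} → a ⪰ b → b ⪰ c → c ⪰ a → c ⪰ b
  ⪰-cycle-reverse {a} {b} {c} a⪰b b⪰c c⪰a with a ≟ b | b ≟ c | c ≟ a
  ... | yes refl | _        | _        = c⪰a
  ... | _        | yes refl | _        = ⪰-refl c
  ... | _        | _        | yes refl = a⪰b
  ... | no a≢b   | no b≢c   | no c≢a   = ⪰-cycle-reverse-distinct a≢b b≢c c≢a a⪰b b⪰c c⪰a

proposition6 : ∀ {c ℓ₁ ℓ₂ : Level} (O : TotalOrder c ℓ₁ ℓ₂) (G : GameLadder O) →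
    GameLadder.Linear G →
    ∀ (i j k : Fin (GameLadder.n G)) →
    GameLadder._≻_ G i j → GameLadder._≻_ G j k → GameLadder._≻_ G i k
proposition6 O G linear i j k (i⪰j , _) (j⪰k , k⋡j) = i⪰k , k⋡i
  where
  open GameLadder G using (_⪰_)

  k⋡i : ¬ (k ⪰ i)
  k⋡i k⪰i = k⋡j (⪰-cycle-reverse G i⪰j j⪰k k⪰i)

  i⪰k : i ⪰ k
  i⪰k = [ id , ⊥-elim ∘ k⋡i ]′ (linear i k)
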